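{- Let $a,b\geq 1$, $c=1$, $d=a+b+c$, and let $n\geq d$ be an integer. Consider the $n$-ModSum protocol for card deals of size $(a,b,1)$, in which Alice publicly announces $\sum_n A$ and Bob publicly announces $\sum_n B$. Then the protocol is informative: for every deal $(A,B,C)$ of size $(a,b,1)$, after Alice's announcement of $\sum_n A$ Bob knows the whole card deal, and after Bob's announcement of $\sum_n B$ Alice knows the whole card deal.
   Context: Cards are the integers $0,1,\dots,d-1$, $D=\{0,\dots,d-1\}$. A card deal of size $(a,b,c)$ (with $a,b,c\geq 1$, $a+b+c=d$) is a triple $(A,B,C)$ of pairwise disjoint subsets of $D$ with $|A|=a$, $|B|=b$, $|C|=c$; Alice holds $A$, Bob holds $B$, Cath holds $C$, and initially each player knows only her own hand (and the sizes $a,b,c$). For $X\subseteq D$ and $n\geq d$, $\sum_n X$ denotes the sum of the elements of $X$ in $\mathbb Z/(n)$. An announcement by a player is truthful and publicly restricts the set of possible deals to those consistent with it (e.g. announcing $\sum_n A=s$ restricts to deals $(A',B',C')$ with $\sum_n A'=s$). A player knows a fact if it holds in all deals that are consistent with the announcements made so far and in which that player has her actual hand; a player knows the card deal if exactly one such deal remains. -}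

module Defs where

open import Data.Nat using (ℕ; zero; suc; _+_; NonZero)
open import Data.Nat.DivMod using (_%_)
open import Data.Bool using (if_then_else_)
open import Data.Fin using (Fin; toℕ)
open import Data.Fin.Subset using (Subset; ∣_∣; _∩_; Empty)
open import Data.Vec using (tabulate; lookup; sum)
open import Data.Product using (_×_)
open import Relation.Binary.PropositionalEquality using (_≡_)

cardSum : {d : ℕ} → Subset d → ℕ
cardSum X = sum (tabulate (λ i → if lookup X i then toℕ i else 0))

-- Σ_n X : the sum of the elements of X in ℤ/(n), represented by its residue in {0,…,n-1}.
sumMod : {d : ℕ} (n : ℕ) .{{_ : NonZero n}} → Subset d → ℕ
sumMod n X = cardSum X % n

record Deal (d a b c : ℕ) : Set where
  constructor deal
  field
    handA : Subset d
    handB : Subset d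
    handC : Subset d
    sizeA : ∣ handA ∣ ≡ a
    sizeB : ∣ handB ∣ ≡ b
    sizeC : ∣ handC ∣ ≡ c
    disjAB : Empty (handA ∩ handB)
    disjAC : Empty (handA ∩ handC)
    disjBC : Empty (handB ∩ handC)
open Deal public

SameDeal : {d a b c : ℕ} → Deal d a b c → Deal d a b c → Set
SameDeal δ δ' = (handA δ ≡ handA δ') × (handB δ ≡ handB δ') × (handC δ ≡ handC δ')

AliceAnnConsistent : {d a b c : ℕ} (n : ℕ) .{{_ : NonZero n}} → Deal d a b c → Deal d a b c → Set
AliceAnnConsistent n δ δ' = sumMod n (handA δ') ≡ sumMod n (handA δ)

BobAnnConsistent : {d a b c : ℕ} (n : ℕ) .{{_ : NonZero n}} → Deal d a b c → Deal d a b c → Set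
BobAnnConsistent n δ δ' = sumMod n (handB δ') ≡ sumMod n (handB δ)

-- A player knows the deal if exactly one deal remains among those consistent with the
-- announcements and in which the player holds her actual hand.
ExactlyOne : {d a b c : ℕ} → (Deal d a b c → Set) → Deal d a b c → Set
ExactlyOne Possible δ = Possible δ × (∀ δ' → Possible δ' → SameDeal δ' δ)

BobKnowsAfterAlice : {d a b c : ℕ} (n : ℕ) .{{_ : NonZero n}} → Deal d a b c → Set
BobKnowsAfterAlice n δ =
  ExactlyOne (λ δ' → AliceAnnConsistent n δ δ' × (handB δ' ≡ handB δ)) δ

AliceKnowsAfterBob : {d a b c : ℕ} (n : ℕ) .{{_ : NonZero n}} → Deal d a b c → Set
AliceKnowsAfterBob n δ =
  ExactlyOne (λ δ' → AliceAnnConsistent n δ δ' × BobAnnConsistent n δ δ' × (handA δ' ≡ handA δ)) δ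

-- Since A, B and C = {x} partition the cards, ΣA + ΣB + x is the fixed total 0 + 1 + ⋯ + (d - 1).
-- A player who knows one of the hands A, B and hears the other one's sum modulo n thus learns
-- x modulo n, hence x itself because x < d ≤ n; the remaining hand is then the complement.
module Submission where

open import Defs
open import Data.Nat using (ℕ; _+_; _≤_; _<_; _*_; NonZero; pred)
open import Data.Nat.Properties using (+-assoc; +-comm; +-suc; +-cancelˡ-≡; +-identityʳ; <-≤-trans)
open import Data.Nat.DivMod using (_%_; _/_; m≡m%n+[m/n]*n; [m+kn]%n≡m%n; m<n⇒m%n≡m; %-congˡ)
open import Data.Bool using (if_then_else_)
open import Data.Fin using (Fin; zero; suc; toℕ)
open import Data.Fin.Properties using (toℕ<n; toℕ-injective)
open import Data.Fin.Subset using (Subset; inside; outside; ⊥; ⁅_⁆; ∣_∣; _∩_; Empty)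
open import Data.Fin.Subset.Properties using (drop-∷-Empty)
open import Data.Vec using ([]; _∷_; tabulate; lookup; sum; here)
open import Data.Product using (_×_; _,_; ∃-syntax; map)
open import Data.Empty using (⊥-elim)
open import Relation.Binary.PropositionalEquality
open import Data.Nat.Tactic.RingSolver using (solve-∀)
open ≡-Reasoning

private
  variable
    m k : ℕ

weightSum : (Fin m → ℕ) → Subset m → ℕ
weightSum w X = sum (tabulate (λ i → if lookup X i then w i else 0))

weightSum-⊥ : (w : Fin m → ℕ) → weightSum w (⊥ {m}) ≡ 0
weightSum-⊥ {ℕ.zero} w = refl
weightSum-⊥ {ℕ.suc m} w = weightSum-⊥ (λ i → w (suc i))

weightSum-⁅x⁆ : (w : Fin m → ℕ) (x : Fin m) → weightSum w ⁅ x ⁆ ≡ w x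
weightSum-⁅x⁆ w zero =
  trans (cong (w zero +_) (weightSum-⊥ (λ i → w (suc i)))) (+-identityʳ (w zero))
weightSum-⁅x⁆ w (suc x) = weightSum-⁅x⁆ (λ i → w (suc i)) x

∣p∣≡0⇒p≡⊥ : {p : Subset m} → ∣ p ∣ ≡ 0 → p ≡ ⊥
∣p∣≡0⇒p≡⊥ {p = []} _ = refl
∣p∣≡0⇒p≡⊥ {p = outside ∷ p} eq = cong (outside ∷_) (∣p∣≡0⇒p≡⊥ eq)

∣p∣≡1⇒p≡⁅x⁆ : {p : Subset m} → ∣ p ∣ ≡ 1 → ∃[ x ] p ≡ ⁅ x ⁆
∣p∣≡1⇒p≡⁅x⁆ {p = inside ∷ p} eq = zero , cong (inside ∷_) (∣p∣≡0⇒p≡⊥ (cong pred eq))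
∣p∣≡1⇒p≡⁅x⁆ {p = outside ∷ p} eq = map suc (cong (outside ∷_)) (∣p∣≡1⇒p≡⁅x⁆ eq)

-- DisjointHands p q r k : the hands p, q, r are pairwise disjoint and k cards lie in none of them.
data DisjointHands : ∀ {m} → Subset m → Subset m → Subset m → ℕ → Set where
  []   : DisjointHands [] [] [] 0
  inˡ  : {p q r : Subset m} → DisjointHands p q r k →
         DisjointHands (inside ∷ p) (outside ∷ q) (outside ∷ r) k
  inᵐ  : {p q r : Subset m} → DisjointHands p q r k →
         DisjointHands (outside ∷ p) (inside ∷ q) (outside ∷ r) k
  inʳ  : {p q r : Subset m} → DisjointHands p q r k →
         DisjointHands (outside ∷ p) (outside ∷ q) (inside ∷ r) k
  none : {p q r : Subset m} → DisjointHands p q r k →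
         DisjointHands (outside ∷ p) (outside ∷ q) (outside ∷ r) (ℕ.suc k)

Empty-∩⇒DisjointHands : (p q r : Subset m) → Empty (p ∩ q) → Empty (p ∩ r) → Empty (q ∩ r) →
                        ∃[ k ] DisjointHands p q r k
Empty-∩⇒DisjointHands [] [] [] _ _ _ = 0 , []
Empty-∩⇒DisjointHands (x ∷ p) (y ∷ q) (z ∷ r) p∩q p∩r q∩r =
  extend x y z p∩q p∩r q∩r
    (Empty-∩⇒DisjointHands p q r (drop-∷-Empty p∩q) (drop-∷-Empty p∩r) (drop-∷-Empty q∩r))
  where
  extend : ∀ x y z →
           Empty ((x ∷ p) ∩ (y ∷ q)) → Empty ((x ∷ p) ∩ (z ∷ r)) → Empty ((y ∷ q) ∩ (z ∷ r)) →
           ∃[ k ] DisjointHands p q r k → ∃[ k ] DisjointHands (x ∷ p) (y ∷ q) (z ∷ r) k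
  extend inside  inside  _       p∩q _   _   _       = ⊥-elim (p∩q (zero , here))
  extend inside  _       inside  _   p∩r _   _       = ⊥-elim (p∩r (zero , here))
  extend _       inside  inside  _   _   q∩r _       = ⊥-elim (q∩r (zero , here))
  extend inside  outside outside _   _   _   (k , h) = k , inˡ h
  extend outside inside  outside _   _   _   (k , h) = k , inᵐ h
  extend outside outside inside  _   _   _   (k , h) = k , inʳ h
  extend outside outside outside _   _   _   (k , h) = ℕ.suc k , none h

DisjointHands-size : {p q r : Subset m} → DisjointHands p q r k → ∣ p ∣ + ∣ q ∣ + ∣ r ∣ + k ≡ m
DisjointHands-size [] = refl
DisjointHands-size (inˡ h) = cong ℕ.suc (DisjointHands-size h)
DisjointHands-size {k = k} {p = _ ∷ p} {q = _ ∷ q} {r = _ ∷ r} (inᵐ h) =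
  trans (cong (λ s → s + ∣ r ∣ + k) (+-suc ∣ p ∣ ∣ q ∣)) (cong ℕ.suc (DisjointHands-size h))
DisjointHands-size {k = k} {p = _ ∷ p} {q = _ ∷ q} {r = _ ∷ r} (inʳ h) =
  trans (cong (_+ k) (+-suc (∣ p ∣ + ∣ q ∣) ∣ r ∣)) (cong ℕ.suc (DisjointHands-size h))
DisjointHands-size {k = ℕ.suc k} {p = _ ∷ p} {q = _ ∷ q} {r = _ ∷ r} (none h) =
  trans (+-suc (∣ p ∣ + ∣ q ∣ + ∣ r ∣) k) (cong ℕ.suc (DisjointHands-size h))

Partition : Subset m → Subset m → Subset m → Set
Partition p q r = DisjointHands p q r 0

Empty-∩⇒Partition : (p q r : Subset m) → Empty (p ∩ q) → Empty (p ∩ r) → Empty (q ∩ r) →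
                    ∣ p ∣ + ∣ q ∣ + ∣ r ∣ ≡ m → Partition p q r
Empty-∩⇒Partition p q r p∩q p∩r q∩r size
  with k , h ← Empty-∩⇒DisjointHands p q r p∩q p∩r q∩r
  with refl ← +-cancelˡ-≡ _ k 0
                 (trans (DisjointHands-size h) (trans (sym size) (sym (+-identityʳ _))))
  = h

DisjointHands-swap : {p q r : Subset m} → DisjointHands p q r k → DisjointHands q p r k
DisjointHands-swap [] = []
DisjointHands-swap (inˡ h) = inᵐ (DisjointHands-swap h)
DisjointHands-swap (inᵐ h) = inˡ (DisjointHands-swap h)
DisjointHands-swap (inʳ h) = inʳ (DisjointHands-swap h)
DisjointHands-swap (none h) = none (DisjointHands-swap h)

Partition-unique : {p q q′ r : Subset m} → Partition p q r → Partition p q′ r → q ≡ q′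
Partition-unique [] [] = refl
Partition-unique (inˡ h) (inˡ h′) = cong (outside ∷_) (Partition-unique h h′)
Partition-unique (inᵐ h) (inᵐ h′) = cong (inside ∷_) (Partition-unique h h′)
Partition-unique (inʳ h) (inʳ h′) = cong (outside ∷_) (Partition-unique h h′)

weightSum-Partition : {p q r : Subset m} (w : Fin m → ℕ) → Partition p q r →
                      weightSum w p + weightSum w q + weightSum w r ≡ sum (tabulate w)
weightSum-Partition w [] = refl
weightSum-Partition {p = _ ∷ p} {_ ∷ q} {_ ∷ r} w (inˡ h) =
  trans (moveˡ (w zero) (weightSum w′ p) (weightSum w′ q) (weightSum w′ r))
        (cong (w zero +_) (weightSum-Partition w′ h))
  where w′ = λ i → w (suc i)
        moveˡ : ∀ x a b c → x + a + b + c ≡ x + (a + b + c)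
        moveˡ = solve-∀
weightSum-Partition {p = _ ∷ p} {_ ∷ q} {_ ∷ r} w (inᵐ h) =
  trans (moveᵐ (w zero) (weightSum w′ p) (weightSum w′ q) (weightSum w′ r))
        (cong (w zero +_) (weightSum-Partition w′ h))
  where w′ = λ i → w (suc i)
        moveᵐ : ∀ x a b c → a + (x + b) + c ≡ x + (a + b + c)
        moveᵐ = solve-∀
weightSum-Partition {p = _ ∷ p} {_ ∷ q} {_ ∷ r} w (inʳ h) =
  trans (moveʳ (w zero) (weightSum w′ p) (weightSum w′ q) (weightSum w′ r))
        (cong (w zero +_) (weightSum-Partition w′ h))
  where w′ = λ i → w (suc i)
        moveʳ : ∀ x a b c → a + b + (x + c) ≡ x + (a + b + c)
        moveʳ = solve-∀

m%n≡o%n⇒m+x≡o+y⇒x≡y : ∀ {m o x y} n .{{_ : NonZero n}} →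
                      m % n ≡ o % n → m + x ≡ o + y → x < n → y < n → x ≡ y
m%n≡o%n⇒m+x≡o+y⇒x≡y {m} {o} {x} {y} n m≡o m+x≡o+y x<n y<n = begin
  x                    ≡⟨ m<n⇒m%n≡m x<n ⟨
  x % n                ≡⟨ [m+kn]%n≡m%n x (m / n) n ⟨
  (x + m / n * n) % n  ≡⟨ %-congˡ quotients ⟩
  (y + o / n * n) % n  ≡⟨ [m+kn]%n≡m%n y (o / n) n ⟩
  y % n                ≡⟨ m<n⇒m%n≡m y<n ⟩
  y                    ∎
  where
  split : ∀ u z → u + z ≡ u % n + (z + u / n * n)
  split u z = begin
    u + z                   ≡⟨ cong (_+ z) (m≡m%n+[m/n]*n u n) ⟩
    u % n + u / n * n + z   ≡⟨ +-assoc (u % n) _ z ⟩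
    u % n + (u / n * n + z) ≡⟨ cong (u % n +_) (+-comm _ z) ⟩
    u % n + (z + u / n * n) ∎
  quotients : x + m / n * n ≡ y + o / n * n
  quotients = +-cancelˡ-≡ (o % n) _ _ (begin
    o % n + (x + m / n * n) ≡⟨ cong (_+ _) m≡o ⟨
    m % n + (x + m / n * n) ≡⟨ split m x ⟨
    m + x                   ≡⟨ m+x≡o+y ⟩
    o + y                   ≡⟨ split o y ⟩
    o % n + (y + o / n * n) ∎)

lastCard-determined : ∀ {m} n .{{_ : NonZero n}} → m ≤ n → {p p′ q : Subset m} {x x′ : Fin m} →
  Partition q p ⁅ x ⁆ → Partition q p′ ⁅ x′ ⁆ → cardSum p % n ≡ cardSum p′ % n → x ≡ x′
lastCard-determined {m} n m≤n {p} {p′} {q} {x} {x′} h h′ p≡p′ =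
  toℕ-injective (m%n≡o%n⇒m+x≡o+y⇒x≡y n p≡p′ sums (card<n x) (card<n x′))
  where
  card<n : ∀ z → toℕ z < n
  card<n z = <-≤-trans (toℕ<n z) m≤n
  total : ∀ {p} z → Partition q p ⁅ z ⁆ → cardSum q + (cardSum p + toℕ z) ≡ sum (tabulate (toℕ {m}))
  total {p} z hz = begin
    cardSum q + (cardSum p + toℕ z)       ≡⟨ +-assoc (cardSum q) (cardSum p) (toℕ z) ⟨
    cardSum q + cardSum p + toℕ z         ≡⟨ cong (cardSum q + cardSum p +_) (weightSum-⁅x⁆ toℕ z) ⟨
    cardSum q + cardSum p + cardSum ⁅ z ⁆ ≡⟨ weightSum-Partition toℕ hz ⟩
    sum (tabulate (toℕ {m}))              ∎
  sums : cardSum p + toℕ x ≡ cardSum p′ + toℕ x′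
  sums = +-cancelˡ-≡ (cardSum q) _ _ (trans (total x h) (sym (total x′ h′)))

partition-determined : ∀ n .{{_ : NonZero n}} → m ≤ n → {p p′ q r r′ : Subset m} →
  Partition q p r → Partition q p′ r′ → ∣ r ∣ ≡ 1 → ∣ r′ ∣ ≡ 1 →
  cardSum p % n ≡ cardSum p′ % n → p ≡ p′ × r ≡ r′
partition-determined n m≤n {r = r} {r′} h h′ ∣r∣≡1 ∣r′∣≡1 p≡p′
  with x , refl ← ∣p∣≡1⇒p≡⁅x⁆ {p = r} ∣r∣≡1 | x′ , refl ← ∣p∣≡1⇒p≡⁅x⁆ {p = r′} ∣r′∣≡1
  with refl ← lastCard-determined n m≤n h h′ p≡p′
  = Partition-unique h h′ , refl

Deal-partition : ∀ {a b c} (δ : Deal (a + b + c) a b c) → Partition (handA δ) (handB δ) (handC δ)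
Deal-partition δ = Empty-∩⇒Partition (handA δ) (handB δ) (handC δ) (disjAB δ) (disjAC δ) (disjBC δ)
  (cong₂ _+_ (cong₂ _+_ (sizeA δ) (sizeB δ)) (sizeC δ))

mainTheorem1 : (a b : ℕ) → 1 ≤ a → 1 ≤ b →
    (n : ℕ) .{{_ : NonZero n}} → a + b + 1 ≤ n →
    (δ : Deal (a + b + 1) a b 1) →
    BobKnowsAfterAlice n δ × AliceKnowsAfterBob n δ
mainTheorem1 a b _ _ n d≤n δ = ((refl , refl) , bobKnows) , ((refl , refl , refl) , aliceKnows)
  where
  bobKnows : ∀ δ′ → AliceAnnConsistent n δ δ′ × handB δ′ ≡ handB δ → SameDeal δ′ δ
  bobKnows δ′ (sameSumA , sameB) =
    let sameA , sameC = partition-determined n d≤n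
          (subst (λ q → Partition q (handA δ′) (handC δ′)) sameB
                 (DisjointHands-swap (Deal-partition δ′)))
          (DisjointHands-swap (Deal-partition δ)) (sizeC δ′) (sizeC δ) sameSumA
    in sameA , sameB , sameC
  aliceKnows : ∀ δ′ → AliceAnnConsistent n δ δ′ × BobAnnConsistent n δ δ′ × handA δ′ ≡ handA δ →
               SameDeal δ′ δ
  aliceKnows δ′ (_ , sameSumB , sameA) =
    let sameB , sameC = partition-determined n d≤n
          (subst (λ p → Partition p (handB δ′) (handC δ′)) sameA (Deal-partition δ′))
          (Deal-partition δ) (sizeC δ′) (sizeC δ) sameSumB
    in sameA , sameB , sameC
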